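{- Let $X$ be a totally ordered set, let $k\ge4$ be a power of $2$, and let $\bar{b}=\langle b_1,\dots,b_k\rangle\in X^k$ be v-shape s-dominating at some point $i$. Then $\langle b_1,\dots,b_{k/4}\rangle\succeq\langle b_{k/2+1},\dots,b_{3k/4}\rangle$.
   Context: $\bar{b}$ is v-shaped if $b_1\ge\dots\ge b_i\le\dots\le b_k$ for some $i$; it is s-dominating if $b_j\ge b_{k-j+1}$ for all $1\le j\le k/2$. A v-shaped s-dominating $\bar{b}$ is v-shape s-dominating at point $i$ if $i$ is the smallest index greater than $k/2$ with $b_i<b_{i+1}$, or $i=k$ if $\bar b$ is non-increasing. For sequences $\bar{a},\bar{c}$, $\bar{a}\succeq\bar{c}$ means every element of $\bar a$ is $\ge$ every element of $\bar c$. -}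

module Defs where

open import Level using (Level)
open import Data.Nat using (ℕ; suc; _+_; _*_; _∸_; _^_; _<_) renaming (_≤_ to _≤ℕ_)
open import Data.Product using (_×_; Σ; ∃)
open import Data.Sum using (_⊎_)
open import Relation.Nullary using (¬_)
open import Relation.Binary.PropositionalEquality using (_≡_)
open import Relation.Binary.Bundles using (TotalOrder)

IsPowerOf2 : ℕ → Set
IsPowerOf2 k = ∃ λ m → k ≡ 2 ^ m

module Seq {c ℓ₁ ℓ₂ : Level} (X : TotalOrder c ℓ₁ ℓ₂) where
  open TotalOrder X

  _<X_ : Carrier → Carrier → Set (ℓ₁ Level.⊔ ℓ₂)
  a <X b = a ≤ b × ¬ (a ≈ b)

  -- A sequence b_1,...,b_k is represented by b : ℕ → Carrier, of which only
  -- the values b 1, ..., b k are ever used.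

  VShaped : ℕ → (ℕ → Carrier) → Set ℓ₂
  VShaped k b = ∃ λ i → (1 ≤ℕ i) × (i ≤ℕ k)
    × (∀ j → 1 ≤ℕ j → j < i → b (suc j) ≤ b j)
    × (∀ j → i ≤ℕ j → j < k → b j ≤ b (suc j))

  SDominating : ℕ → (ℕ → Carrier) → Set ℓ₂
  SDominating k b = ∀ j → 1 ≤ℕ j → 2 * j ≤ℕ k → b (suc (k ∸ j)) ≤ b j

  NonIncreasing : ℕ → (ℕ → Carrier) → Set ℓ₂
  NonIncreasing k b = ∀ j → 1 ≤ℕ j → j < k → b (suc j) ≤ b j

  -- i is the smallest index greater than k/2 with b_i < b_{i+1}
  -- (k/2 < i written as k < 2 * i; i+1 must be an index, so i < k)
  FirstAscentAfterHalf : ℕ → (ℕ → Carrier) → ℕ → Set (ℓ₁ Level.⊔ ℓ₂)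
  FirstAscentAfterHalf k b i = (k < 2 * i) × (i < k) × (b i <X b (suc i))
    × (∀ j → k < 2 * j → j < i → ¬ (b j <X b (suc j)))

  VShapeSDomAt : ℕ → (ℕ → Carrier) → ℕ → Set (ℓ₁ Level.⊔ ℓ₂)
  VShapeSDomAt k b i = VShaped k b × SDominating k b
    × (FirstAscentAfterHalf k b i ⊎ (i ≡ k × NonIncreasing k b))

  Dominates : (ℕ → Carrier) → ℕ → ℕ → ℕ → ℕ → Set (ℓ₂)
  Dominates b lo₁ hi₁ lo₂ hi₂ = ∀ p q → lo₁ ≤ℕ p → p ≤ℕ hi₁ → lo₂ ≤ℕ q → q ≤ℕ hi₂ → b q ≤ b p

{-# OPTIONS --safe #-}
module Submission where

open import Defs
open import Level using (Level)
open import Data.Nat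
  using (ℕ; zero; suc; _+_; _∸_; _*_; _/_; _^_; _≤_; _<_; _≤′_; ≤′-refl; ≤′-step; s≤s; z≤n; _≤?_)
open import Data.Nat.Properties
open import Data.Nat.DivMod using (m*n/n≡m)
open import Data.Nat.Divisibility using (_∣_; divides; divides-refl)
open import Data.Product using (∃; _,_; _×_)
open import Relation.Binary.Bundles using (TotalOrder)
open import Function using (flip)
open import Relation.Binary.Core using (Rel)
open import Relation.Binary.Definitions using (Reflexive; Transitive)
open import Relation.Nullary using (yes; no)
open import Relation.Binary.PropositionalEquality using (_≡_; refl; sym; trans; cong; subst)

-- For p in the first quarter and q in the third, p ≤ q ≤ k - p + 1. If q does not pass the valley
-- of the v-shape, b descends from p to q; otherwise b ascends from q to k - p + 1, and
-- b (k - p + 1) ≤ b p by s-domination.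

module _ {a ℓ} {A : Set a} (_∼_ : Rel A ℓ) (∼-refl : Reflexive _∼_) (∼-trans : Transitive _∼_)
         (f : ℕ → A) where

  stepwise⇒ordered : ∀ {lo hi} → (∀ j → lo ≤ j → j < hi → f j ∼ f (suc j)) →
                     ∀ {p q} → lo ≤ p → p ≤ q → q ≤ hi → f p ∼ f q
  stepwise⇒ordered {lo} {hi} step {p} lo≤p p≤q = go (≤⇒≤′ p≤q)
    where
    go : ∀ {q} → p ≤′ q → q ≤ hi → f p ∼ f q
    go ≤′-refl            _    = ∼-refl
    go (≤′-step {n} p≤′n) n<hi =
      ∼-trans (go p≤′n (<⇒≤ n<hi)) (step n (≤-trans lo≤p (≤′⇒≤ p≤′n)) n<hi)

mirror : ℕ → ℕ → ℕ
mirror k p = suc (k ∸ p)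

mirror≤ : ∀ k {p} → 1 ≤ p → 2 * p ≤ k → mirror k p ≤ k
mirror≤ k {p} 1≤p 2p≤k = ∸-monoʳ-< {k} {p} {0} 1≤p (≤-trans (m≤m+n p (p + 0)) 2p≤k)

module VShapedSDominating {c ℓ₁ ℓ₂ : Level} (X : TotalOrder c ℓ₁ ℓ₂) where
  open TotalOrder X using () renaming (_≤_ to _≤X_; refl to ≤X-refl; trans to ≤X-trans)
  open Seq X

  ≤-up-to-mirror : ∀ {k b} → VShaped k b → SDominating k b →
                   ∀ {p q} → 1 ≤ p → 2 * p ≤ k → p ≤ q → q ≤ mirror k p → b q ≤X b p
  ≤-up-to-mirror {k} {b} (v , _ , _ , descending , ascending) sDom {p} {q} 1≤p 2p≤k p≤q q≤mirror
    with q ≤? v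
  ... | yes q≤v = stepwise⇒ordered (flip _≤X_) ≤X-refl (flip ≤X-trans) b descending 1≤p p≤q q≤v
  ... | no  q≰v = ≤X-trans
    (stepwise⇒ordered _≤X_ ≤X-refl ≤X-trans b ascending (<⇒≤ (≰⇒> q≰v)) q≤mirror (mirror≤ k 1≤p 2p≤k))
    (sDom p 1≤p 2p≤k)

4∣powerOf2 : ∀ {k} → IsPowerOf2 k → 4 ≤ k → 4 ∣ k
4∣powerOf2 (zero , refl)         (s≤s ())
4∣powerOf2 (suc zero , refl)     (s≤s (s≤s ()))
4∣powerOf2 (suc (suc m) , refl) _ =
  divides (2 ^ m) (trans (sym (*-assoc 2 2 (2 ^ m))) (*-comm 4 (2 ^ m)))

quarter-bounds : ∀ t {p q} → p ≤ t * 4 / 4 → t * 4 / 2 + 1 ≤ q → q ≤ 3 * (t * 4) / 4 →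
                 p ≤ q × 2 * p ≤ t * 4 × q ≤ mirror (t * 4) p
quarter-bounds t {p} {q} p≤k/4 k/2<q q≤3k/4 = p≤q , 2p≤k , q≤mirror
  where
  open ≤-Reasoning

  k/4≡t : t * 4 / 4 ≡ t
  k/4≡t = m*n/n≡m t 4

  k/2≡2t : t * 4 / 2 ≡ t * 2
  k/2≡2t = trans (cong (_/ 2) (sym (*-assoc t 2 2))) (m*n/n≡m (t * 2) 2)

  3k/4≡3t : 3 * (t * 4) / 4 ≡ 3 * t
  3k/4≡3t = trans (cong (_/ 4) (sym (*-assoc 3 t 4))) (m*n/n≡m (3 * t) 4)

  p≤t : p ≤ t
  p≤t = subst (p ≤_) k/4≡t p≤k/4

  p≤q : p ≤ q
  p≤q = begin
    p             ≤⟨ p≤t ⟩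
    t             ≤⟨ m≤m*n t 2 ⟩
    t * 2         ≤⟨ m≤m+n (t * 2) 1 ⟩
    t * 2 + 1     ≡⟨ cong (_+ 1) k/2≡2t ⟨
    t * 4 / 2 + 1 ≤⟨ k/2<q ⟩
    q             ∎

  2p≤k : 2 * p ≤ t * 4
  2p≤k = begin
    2 * p ≡⟨ *-comm 2 p ⟩
    p * 2 ≤⟨ *-monoˡ-≤ 2 p≤t ⟩
    t * 2 ≤⟨ *-monoʳ-≤ t (s≤s (s≤s z≤n)) ⟩
    t * 4 ∎

  q≤mirror : q ≤ mirror (t * 4) p
  q≤mirror = begin
    q                ≤⟨ subst (q ≤_) 3k/4≡3t q≤3k/4 ⟩
    3 * t            ≡⟨ m+n∸n≡m (3 * t) t ⟨
    3 * t + t ∸ t    ≡⟨ cong (_∸ t) (trans (+-comm (3 * t) t) (*-comm 4 t)) ⟩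
    t * 4 ∸ t        ≤⟨ ∸-monoʳ-≤ (t * 4) p≤t ⟩
    t * 4 ∸ p        ≤⟨ n≤1+n (t * 4 ∸ p) ⟩
    mirror (t * 4) p ∎

mainTheorem7 : ∀ {c ℓ₁ ℓ₂ : Level} (X : TotalOrder c ℓ₁ ℓ₂) (k : ℕ) → 4 ≤ k → IsPowerOf2 k
    → (b : ℕ → TotalOrder.Carrier X)
    → (∃ λ i → Seq.VShapeSDomAt X k b i)
    → Seq.Dominates X b 1 (k / 4) (k / 2 + 1) ((3 * k) / 4)
mainTheorem7 X k 4≤k powerOf2 b (_ , vShaped , sDom , _) p q 1≤p p≤k/4 k/2<q q≤3k/4
  with 4∣powerOf2 powerOf2 4≤k
... | divides-refl t with quarter-bounds t p≤k/4 k/2<q q≤3k/4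
...   | p≤q , 2p≤k , q≤mirror =
  VShapedSDominating.≤-up-to-mirror X vShaped sDom 1≤p 2p≤k p≤q q≤mirror
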